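{- For every instance of problem FM with $m=3$ machines and $k=3$ ranks (i.e. $n=9$ jobs, after padding with zero-length jobs), every LD schedule satisfies $t_{LD}\le \frac{13}{11}\,t^*$; that is, the Coffman–Sethi conjecture holds for $m=3$, $k=3$.
   Context: Problem FM: there are $m\ge 1$ identical parallel machines and $n=mk$ jobs ($k\ge 1$ is the number of ranks; an instance with fewer jobs is padded with jobs of processing time $0$), with nonnegative real processing times indexed so that $p_1\ge p_2\ge\cdots\ge p_n$. For $r\in\{1,\dots,k\}$, rank $r$ is the set of jobs $(r-1)m+1,\dots,rm$. A flowtime-optimal schedule assigns to every machine exactly one job from each rank and processes the jobs on each machine consecutively from time $0$ without idle time, in the order rank $k$, rank $k-1$, \dots, rank $1$; its makespan is the largest machine completion time. $t^*$ denotes the minimum makespan over all flowtime-optimal schedules. LD algorithm: ranks are handled in the order $1,2,\dots,k$; when handling a rank, the largest job of that rank is assigned to a machine of smallest current load (sum of processing times of jobs already assigned), the second largest to a machine of second smallest load, \dots, the smallest to a machine of largest load (ties broken arbitrarily); at the end the order of jobs on each machine is reversed, yielding a flowtime-optimal schedule. Any schedule obtainable this way is an LD schedule, and $t_{LD}$ denotes its makespan. The Coffman–Sethi conjecture asserts that for every $m$, every instance on $m$ machines and every LD schedule of it, $t_{LD}\le\frac{5m-2}{4m-1}t^*$.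
   Formalization: The processing times of the instance are rational rather than real. -}

module Defs where

open import Data.Nat using (ℕ; zero; suc; _<ᵇ_)
import Data.Nat
open import Data.Fin using (Fin; zero; suc; toℕ; _≤_)
open import Data.Fin.Permutation using (Permutation′; _⟨$⟩ʳ_)
open import Data.Bool using (if_then_else_)
open import Data.Product using (Σ; _×_)
open import Data.Rational using (ℚ; 0ℚ; _+_; _⊔_) renaming (_≤_ to _≤ℚ_)

sumFin : (n : ℕ) → (Fin n → ℚ) → ℚ
sumFin zero    f = 0ℚ
sumFin (suc n) f = f zero + sumFin n (λ i → f (suc i))

maxFin : (n : ℕ) → (Fin n → ℚ) → ℚ
maxFin zero    f = 0ℚ
maxFin (suc n) f = f zero ⊔ maxFin n (λ i → f (suc i))

-- Processing times of an FM instance with m machines and k ranks: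
-- p r j is the processing time of job number r*m + j + 1 (0-based r, j),
-- i.e. the (j+1)-th job of rank r+1.
Times : ℕ → ℕ → Set
Times m k = Fin k → Fin m → ℚ

-- Nonnegative and indexed so that p_1 ≥ p_2 ≥ ... ≥ p_n (lexicographic order
-- on (rank, position) is the global job order).
ValidInstance : ∀ {m k} → Times m k → Set
ValidInstance {m} {k} p =
  (∀ r j → 0ℚ ≤ℚ p r j) ×
  (∀ r j j' → j ≤ j' → p r j' ≤ℚ p r j) ×
  (∀ (r r' : Fin k) (j j' : Fin m) → toℕ r Data.Nat.< toℕ r' → p r' j' ≤ℚ p r j)

-- A flowtime-optimal schedule: for each rank r, a bijection between machines
-- and the jobs of rank r; machine i receives job (σ r ⟨$⟩ʳ i) of rank r.
-- (The within-machine order rank k, ..., rank 1 does not affect completion times.)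
Schedule : ℕ → ℕ → Set
Schedule m k = Fin k → Permutation′ m

load : ∀ {m k} → Times m k → Schedule m k → Fin m → ℚ
load {m} {k} p σ i = sumFin k (λ r → p r (σ r ⟨$⟩ʳ i))

makespan : ∀ {m k} → Times m k → Schedule m k → ℚ
makespan {m} p σ = maxFin m (load p σ)

loadBefore : ∀ {m k} → Times m k → Schedule m k → Fin k → Fin m → ℚ
loadBefore {m} {k} p σ r i =
  sumFin k (λ r' → if toℕ r' <ᵇ toℕ r then p r' (σ r' ⟨$⟩ʳ i) else 0ℚ)

-- σ is an LD schedule: when rank r is handled, there is an ordering π of the
-- machines by nondecreasing current load (ties arbitrary) such that the jobs of
-- rank r assigned along π are nonincreasing (largest job to smallest load, ...).
IsLD : ∀ {m k} → Times m k → Schedule m k → Set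
IsLD {m} {k} p σ =
  ∀ (r : Fin k) → Σ (Permutation′ m) λ π →
    ∀ (a b : Fin m) → a ≤ b →
      (loadBefore p σ r (π ⟨$⟩ʳ a) ≤ℚ loadBefore p σ r (π ⟨$⟩ʳ b)) ×
      (p r (σ r ⟨$⟩ʳ (π ⟨$⟩ʳ b)) ≤ℚ p r (σ r ⟨$⟩ʳ (π ⟨$⟩ʳ a)))

module Submission where

-- After the first two ranks LD has paired a₃ with b₁, a₂ with b₂ and a₁ with b₃ (ties do
-- not change the resulting loads), and the third rank puts c₁, c₂, c₃ on the machines with
-- the smallest, middle and largest of these partial loads.  Any flowtime-optimal schedule
-- has makespan t at least the average load and at least a₁+b₃+c₃, a₃+b₁+c₃, a₃+b₃+c₁ (the
-- machines holding a₁, b₁, c₁) and a₂+b₂+c₃, a₂+b₃+c₂ (some machine holds one of the two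
-- largest jobs of rank 1 and one of the two largest of rank 2, resp. 3).  Each LD load is
-- at most 13t/11 by a nonnegative combination of these bounds and the ordering of the
-- jobs; the middle load needs a case split on which two partial loads it lies below.

open import Defs
open import Data.Integer using (+_)
open import Data.Rational using (ℚ; _/_; _*_; _≤_)

import Data.Rational.Properties as ℚ
open import Algebra.Properties.CommutativeMonoid.Sum ℚ.+-0-commutativeMonoid
  using (sum; sum-syntax; ∑-comm; sum-permute; sum-cong-≗)
open import Data.Empty using (⊥-elim)
open import Data.Fin as Fin using (Fin; zero; suc; opposite)
open import Data.Fin.Patterns using (0F; 1F; 2F)
open import Data.Fin.Permutation
  using (Permutation′; _⟨$⟩ʳ_; _⟨$⟩ˡ_; inverseʳ; reverse; flip; _∘ₚ_)
open import Data.Fin.Properties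
  using (injective⇒existsPivot; opposite-prop; opposite-involutive; ≤fromℕ)
import Data.Fin.Properties as Fin
open import Data.List using (_∷_; [])
import Data.Maybe as Maybe
open import Data.Nat as ℕ using (z≤n; s≤s)
open import Data.Nat.Properties using (∸-monoʳ-≤)
open import Data.Product using (∃; _×_; _,_; proj₁; proj₂)
open import Data.Rational using (0ℚ; _+_; _-_; -_; _⊔_; NonNegative)
open import Data.Sum using (_⊎_; inj₁; inj₂)
open import Function using (_∘_; _∋_; Injective; Injection)
open import Function.Properties.Inverse using (↔⇒↣)
open import Level using (0ℓ)
open import Relation.Binary using (Poset; DecTotalOrder)
open import Relation.Binary.Definitions using (Antitonic₁; Monotonic₁)
open import Relation.Binary.PropositionalEquality
open import Relation.Nullary.Decidable using (dec⇒maybe)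
open import Tactic.RingSolver using (solve)
import Tactic.RingSolver.Core.AlmostCommutativeRing as ACR

ℚ-ring : ACR.AlmostCommutativeRing 0ℓ 0ℓ
ℚ-ring = ACR.fromCommutativeRing ℚ.+-*-commutativeRing
  (λ x → Maybe.map sym (dec⇒maybe (x ℚ.≟ 0ℚ)))

≤-by-combination : ∀ {x y l r : ℚ} → l ≤ r → x + r ≡ y + l → x ≤ y
≤-by-combination {x} {y} {l} {r} l≤r x+r≡y+l = begin
  x           ≡⟨ solve (x ∷ r ∷ []) ℚ-ring ⟩
  (x + r) - r ≡⟨ cong (_- r) x+r≡y+l ⟩
  (y + l) - r ≤⟨ ℚ.+-monoˡ-≤ (- r) (ℚ.+-monoʳ-≤ y l≤r) ⟩
  (y + r) - r ≡⟨ solve (y ∷ r ∷ []) ℚ-ring ⟩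
  y           ∎
  where open ℚ.≤-Reasoning

infixl 6 _⊕_
infix 7 _⊗_

_⊕_ : ∀ {a b c d : ℚ} → a ≤ b → c ≤ d → a + c ≤ b + d
_⊕_ = ℚ.+-mono-≤

_⊗_ : ∀ (c : ℚ) .{{_ : NonNegative c}} {x y : ℚ} → x ≤ y → c * x ≤ c * y
c ⊗ x≤y = ℚ.*-monoˡ-≤-nonNeg c x≤y

opposite-antitone : ∀ {n} → Antitonic₁ Fin._≤_ Fin._≤_ (opposite {n})
opposite-antitone {n} {i} {j} j≤i =
  subst₂ ℕ._≤_ (sym (opposite-prop i)) (sym (opposite-prop j)) (∸-monoʳ-≤ n (s≤s j≤i))

module _ {c ℓ₁ ℓ₂} (P : Poset c ℓ₁ ℓ₂) where
  open Poset P renaming (_≤_ to _⊑_)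
  open import Relation.Binary.Reasoning.PartialOrder P

  antitone-injective-⊑ : ∀ {n} {w : Fin n → Carrier} {f : Fin n → Fin n} →
    Injective _≡_ _≡_ f → Antitonic₁ Fin._≤_ _⊑_ w → Antitonic₁ Fin._≤_ _⊑_ (w ∘ f) →
    ∀ i → w (f i) ⊑ w i
  antitone-injective-⊑ {w = w} {f} f-injective w↘ wf↘ i
    with injective⇒existsPivot f-injective i
  ... | k , k≤i , i≤fk = begin
    w (f i) ≤⟨ wf↘ k≤i ⟩
    w (f k) ≤⟨ w↘ i≤fk ⟩
    w i     ∎

  antitone-permute : ∀ {n} {w : Fin n → Carrier} (π : Permutation′ n) →
    Antitonic₁ Fin._≤_ _⊑_ w → Antitonic₁ Fin._≤_ _⊑_ (w ∘ (π ⟨$⟩ʳ_)) →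
    ∀ i → w (π ⟨$⟩ʳ i) ≈ w i
  antitone-permute {w = w} π w↘ wπ↘ i = antisym
    (antitone-injective-⊑ (Injection.injective (↔⇒↣ π)) w↘ wπ↘ i)
    (subst (_⊑ w (π ⟨$⟩ʳ i)) (cong w (inverseʳ π))
      (antitone-injective-⊑ (Injection.injective (↔⇒↣ (flip π))) wπ↘ wππ⁻¹↘ i))
    where
    wππ⁻¹↘ : Antitonic₁ Fin._≤_ _⊑_ (λ j → w (π ⟨$⟩ʳ (π ⟨$⟩ˡ j)))
    wππ⁻¹↘ = subst₂ _⊑_ (cong w (sym (inverseʳ π))) (cong w (sym (inverseʳ π))) ∘ w↘

  monotone-permute : ∀ {n} {w : Fin n → Carrier} (π : Permutation′ n) →
    Antitonic₁ Fin._≤_ _⊑_ w → Monotonic₁ Fin._≤_ _⊑_ (w ∘ (π ⟨$⟩ʳ_)) →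
    ∀ i → w (π ⟨$⟩ʳ i) ≈ w (opposite i)
  monotone-permute {w = w} π w↘ wπ↗ i =
    subst (λ j → w (π ⟨$⟩ʳ j) ≈ w (opposite i)) (opposite-involutive i)
      (antitone-permute (reverse ∘ₚ π) w↘ (wπ↗ ∘ opposite-antitone) (opposite i))

ℚ-poset : Poset 0ℓ 0ℓ 0ℓ
ℚ-poset = DecTotalOrder.poset ℚ.≤-decTotalOrder

sumFin≡sum : ∀ n (f : Fin n → ℚ) → sumFin n f ≡ sum f
sumFin≡sum ℕ.zero    f = refl
sumFin≡sum (ℕ.suc n) f = cong (λ s → f zero + s) (sumFin≡sum n (f ∘ suc))

sumFin-mono : ∀ n {f g : Fin n → ℚ} → (∀ i → f i ≤ g i) → sumFin n f ≤ sumFin n g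
sumFin-mono ℕ.zero    f≤g = ℚ.≤-refl
sumFin-mono (ℕ.suc n) f≤g = f≤g zero ⊕ sumFin-mono n (f≤g ∘ suc)

sumFin-3 : ∀ (f : Fin 3 → ℚ) → sumFin 3 f ≡ f 0F + f 1F + f 2F
sumFin-3 f = trans (cong (λ s → f 0F + (f 1F + s)) (ℚ.+-identityʳ (f 2F)))
  (sym (ℚ.+-assoc (f 0F) (f 1F) (f 2F)))

sumFin-load : ∀ {m k} (p : Times m k) (σ : Schedule m k) →
  sumFin m (load p σ) ≡ sumFin k (λ r → sumFin m (p r))
sumFin-load {m} {k} p σ = begin
  sumFin m (load p σ)             ≡⟨ sumFin≡sum m (load p σ) ⟩
  ∑[ i < m ] load p σ i           ≡⟨ sum-cong-≗ (λ i → sumFin≡sum k (λ r → job r i)) ⟩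
  ∑[ i < m ] ∑[ r < k ] job r i   ≡⟨ ∑-comm (λ i r → job r i) ⟩
  ∑[ r < k ] ∑[ i < m ] job r i   ≡⟨ sum-cong-≗ (λ r → sum-permute (p r) (σ r)) ⟨
  ∑[ r < k ] sum (p r)            ≡⟨ sum-cong-≗ (λ r → sumFin≡sum m (p r)) ⟨
  ∑[ r < k ] sumFin m (p r)       ≡⟨ sumFin≡sum k (λ r → sumFin m (p r)) ⟨
  sumFin k (λ r → sumFin m (p r)) ∎
  where
  open ≡-Reasoning
  job : Fin k → Fin m → ℚ
  job r i = p r (σ r ⟨$⟩ʳ i)

≤-maxFin : ∀ n (f : Fin n → ℚ) i → f i ≤ maxFin n f
≤-maxFin (ℕ.suc n) f zero    = ℚ.p≤p⊔q (f zero) _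
≤-maxFin (ℕ.suc n) f (suc i) = ℚ.≤-trans (≤-maxFin n (f ∘ suc) i) (ℚ.p≤q⊔p (f zero) _)

0≤maxFin : ∀ n (f : Fin n → ℚ) → 0ℚ ≤ maxFin n f
0≤maxFin ℕ.zero    f = ℚ.≤-refl
0≤maxFin (ℕ.suc n) f = ℚ.≤-trans (0≤maxFin n (f ∘ suc)) (ℚ.p≤q⊔p (f zero) _)

maxFin-lub : ∀ n {f : Fin n → ℚ} {t} → (∀ i → f i ≤ t) → 0ℚ ≤ t → maxFin n f ≤ t
maxFin-lub ℕ.zero    f≤t 0≤t = 0≤t
maxFin-lub (ℕ.suc n) f≤t 0≤t = ℚ.⊔-lub (f≤t zero) (maxFin-lub n (f≤t ∘ suc) 0≤t)

*-distribˡ-maxFin : ∀ c .{{_ : NonNegative c}} n (f : Fin n → ℚ) →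
  c * maxFin n f ≡ maxFin n (λ i → c * f i)
*-distribˡ-maxFin c ℕ.zero    f = ℚ.*-zeroʳ c
*-distribˡ-maxFin c (ℕ.suc n) f = trans (ℚ.*-distribˡ-⊔-nonNeg c (f zero) _)
  (cong (c * f zero ⊔_) (*-distribˡ-maxFin c n (f ∘ suc)))

record Ordered (a₁ a₂ a₃ b₁ b₂ b₃ c₁ c₂ c₃ : ℚ) : Set where
  field
    a₂≤a₁ : a₂ ≤ a₁
    a₃≤a₂ : a₃ ≤ a₂
    b₁≤a₃ : b₁ ≤ a₃
    b₂≤b₁ : b₂ ≤ b₁
    b₃≤b₂ : b₃ ≤ b₂
    c₁≤b₃ : c₁ ≤ b₃
    c₂≤c₁ : c₂ ≤ c₁
    c₃≤c₂ : c₃ ≤ c₂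
    0≤c₃  : 0ℚ ≤ c₃

record LowerBounds (a₁ a₂ a₃ b₁ b₂ b₃ c₁ c₂ c₃ t : ℚ) : Set where
  field
    a₁+b₃+c₃≤t : a₁ + b₃ + c₃ ≤ t
    a₂+b₂+c₃≤t : a₂ + b₂ + c₃ ≤ t
    a₂+b₃+c₂≤t : a₂ + b₃ + c₂ ≤ t
    a₃+b₁+c₃≤t : a₃ + b₁ + c₃ ≤ t
    a₃+b₃+c₁≤t : a₃ + b₃ + c₁ ≤ t
    Σ≤3t       : (a₁ + a₂ + a₃) + (b₁ + b₂ + b₃) + (c₁ + c₂ + c₃) ≤ t + t + t
    0≤t        : 0ℚ ≤ t

-- Each weight vector is a dual solution of the linear program maximising the left-hand side
-- under the hypotheses.  The hypotheses spell out the partial loads A j because the ring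
-- solver treats every subterm not built from variables and ring operations as a constant.
module Certificates {a₁ a₂ a₃ b₁ b₂ b₃ c₁ c₂ c₃ t : ℚ}
  (ordered : Ordered a₁ a₂ a₃ b₁ b₂ b₃ c₁ c₂ c₃)
  (bounds : LowerBounds a₁ a₂ a₃ b₁ b₂ b₃ c₁ c₂ c₃ t) where
  open Ordered ordered
  open LowerBounds bounds

  c₁-load-bound : ∀ {μ} → μ ≤ a₃ + b₁ → μ ≤ a₂ + b₂ → μ ≤ a₁ + b₃ →
    (+ 11 / 1) * (μ + c₁) ≤ (+ 13 / 1) * t
  c₁-load-bound {μ} μ≤A₀ μ≤A₁ μ≤A₂ = ≤-by-combination
    ((+ 5 / 1) ⊗ μ≤A₀ ⊕ (+ 3 / 1) ⊗ μ≤A₁ ⊕ (+ 3 / 1) ⊗ μ≤A₂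
      ⊕ (+ 4 / 1) ⊗ a₃+b₃+c₁≤t ⊕ (+ 3 / 1) ⊗ Σ≤3t
      ⊕ (+ 2 / 1) ⊗ b₁≤a₃ ⊕ (+ 4 / 1) ⊗ c₁≤b₃ ⊕ (+ 3 / 1) ⊗ c₃≤c₂ ⊕ (+ 6 / 1) ⊗ 0≤c₃)
    (solve (a₁ ∷ a₂ ∷ a₃ ∷ b₁ ∷ b₂ ∷ b₃ ∷ c₁ ∷ c₂ ∷ c₃ ∷ t ∷ μ ∷ []) ℚ-ring)

  c₂-load-bound₀₁ : ∀ {ν} → ν ≤ a₃ + b₁ → ν ≤ a₂ + b₂ → (+ 11 / 1) * (ν + c₂) ≤ (+ 13 / 1) * t
  c₂-load-bound₀₁ {ν} ν≤A₀ ν≤A₁ = ≤-by-combination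
    ((+ 11 / 2) ⊗ ν≤A₀ ⊕ (+ 11 / 2) ⊗ ν≤A₁ ⊕ (+ 11 / 6) ⊗ a₂+b₂+c₃≤t ⊕ (+ 11 / 3) ⊗ Σ≤3t
      ⊕ (+ 11 / 3) ⊗ a₂≤a₁ ⊕ (+ 11 / 3) ⊗ a₃≤a₂ ⊕ (+ 11 / 6) ⊗ b₁≤a₃ ⊕ (+ 11 / 3) ⊗ c₁≤b₃
      ⊕ (+ 22 / 3) ⊗ c₂≤c₁ ⊕ (+ 11 / 2) ⊗ 0≤c₃ ⊕ (+ 1 / 6) ⊗ 0≤t)
    (solve (a₁ ∷ a₂ ∷ a₃ ∷ b₁ ∷ b₂ ∷ b₃ ∷ c₁ ∷ c₂ ∷ c₃ ∷ t ∷ ν ∷ []) ℚ-ring)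

  c₂-load-bound₀₂ : ∀ {ν} → ν ≤ a₃ + b₁ → ν ≤ a₁ + b₃ → (+ 11 / 1) * (ν + c₂) ≤ (+ 13 / 1) * t
  c₂-load-bound₀₂ {ν} ν≤A₀ ν≤A₂ = ≤-by-combination
    ((+ 11 / 2) ⊗ ν≤A₀ ⊕ (+ 11 / 2) ⊗ ν≤A₂ ⊕ (+ 11 / 6) ⊗ a₁+b₃+c₃≤t ⊕ (+ 11 / 3) ⊗ Σ≤3t
      ⊕ (+ 11 / 3) ⊗ a₃≤a₂ ⊕ (+ 11 / 6) ⊗ b₁≤a₃ ⊕ (+ 11 / 3) ⊗ b₃≤b₂ ⊕ (+ 11 / 3) ⊗ c₁≤b₃
      ⊕ (+ 22 / 3) ⊗ c₂≤c₁ ⊕ (+ 11 / 2) ⊗ 0≤c₃ ⊕ (+ 1 / 6) ⊗ 0≤t)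
    (solve (a₁ ∷ a₂ ∷ a₃ ∷ b₁ ∷ b₂ ∷ b₃ ∷ c₁ ∷ c₂ ∷ c₃ ∷ t ∷ ν ∷ []) ℚ-ring)

  c₂-load-bound₁₂ : ∀ {ν} → ν ≤ a₂ + b₂ → ν ≤ a₁ + b₃ → (+ 11 / 1) * (ν + c₂) ≤ (+ 13 / 1) * t
  c₂-load-bound₁₂ {ν} ν≤A₁ ν≤A₂ = ≤-by-combination
    ((+ 11 / 2) ⊗ ν≤A₁ ⊕ (+ 11 / 2) ⊗ ν≤A₂ ⊕ (+ 11 / 3) ⊗ a₁+b₃+c₃≤t ⊕ (+ 11 / 3) ⊗ a₂+b₃+c₂≤t
      ⊕ (+ 11 / 6) ⊗ Σ≤3t ⊕ (+ 11 / 6) ⊗ b₁≤a₃ ⊕ (+ 11 / 3) ⊗ b₂≤b₁ ⊕ (+ 11 / 3) ⊗ c₁≤b₃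
      ⊕ (+ 11 / 2) ⊗ c₂≤c₁ ⊕ (+ 11 / 2) ⊗ 0≤c₃ ⊕ (+ 1 / 6) ⊗ 0≤t)
    (solve (a₁ ∷ a₂ ∷ a₃ ∷ b₁ ∷ b₂ ∷ b₃ ∷ c₁ ∷ c₂ ∷ c₃ ∷ t ∷ ν ∷ []) ℚ-ring)

  x≤t⇒11x≤13t : ∀ {x} → x ≤ t → (+ 11 / 1) * x ≤ (+ 13 / 1) * t
  x≤t⇒11x≤13t {x} x≤t =
    ≤-by-combination ((+ 11 / 1) ⊗ x≤t ⊕ (+ 2 / 1) ⊗ 0≤t) (solve (x ∷ t ∷ []) ℚ-ring)

  A : Fin 3 → ℚ
  A 0F = a₃ + b₁
  A 1F = a₂ + b₂
  A 2F = a₁ + b₃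

  c : Fin 3 → ℚ
  c 0F = c₁
  c 1F = c₂
  c 2F = c₃

  c₂-load-bound : ∀ {ν j j'} → j ≢ j' → ν ≤ A j → ν ≤ A j' →
    (+ 11 / 1) * (ν + c₂) ≤ (+ 13 / 1) * t
  c₂-load-bound {j = 0F} {0F} j≢j' _ _   = ⊥-elim (j≢j' refl)
  c₂-load-bound {j = 0F} {1F} _ ν≤A ν≤A' = c₂-load-bound₀₁ ν≤A ν≤A'
  c₂-load-bound {j = 0F} {2F} _ ν≤A ν≤A' = c₂-load-bound₀₂ ν≤A ν≤A'
  c₂-load-bound {j = 1F} {0F} _ ν≤A ν≤A' = c₂-load-bound₀₁ ν≤A' ν≤A
  c₂-load-bound {j = 1F} {1F} j≢j' _ _   = ⊥-elim (j≢j' refl)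
  c₂-load-bound {j = 1F} {2F} _ ν≤A ν≤A' = c₂-load-bound₁₂ ν≤A ν≤A'
  c₂-load-bound {j = 2F} {0F} _ ν≤A ν≤A' = c₂-load-bound₀₂ ν≤A' ν≤A
  c₂-load-bound {j = 2F} {1F} _ ν≤A ν≤A' = c₂-load-bound₁₂ ν≤A' ν≤A
  c₂-load-bound {j = 2F} {2F} j≢j' _ _   = ⊥-elim (j≢j' refl)

  c₃-load-bound : ∀ j → (+ 11 / 1) * (A j + c₃) ≤ (+ 13 / 1) * t
  c₃-load-bound 0F = x≤t⇒11x≤13t a₃+b₁+c₃≤t
  c₃-load-bound 1F = x≤t⇒11x≤13t a₂+b₂+c₃≤t
  c₃-load-bound 2F = x≤t⇒11x≤13t a₁+b₃+c₃≤t

  sorted-load-bound : (ρ : Permutation′ 3) → Monotonic₁ Fin._≤_ _≤_ (A ∘ (ρ ⟨$⟩ʳ_)) →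
    ∀ k → (+ 11 / 1) * (A (ρ ⟨$⟩ʳ k) + c k) ≤ (+ 13 / 1) * t
  sorted-load-bound ρ Aρ↗ 0F = c₁-load-bound (Aρ₀≤A 0F) (Aρ₀≤A 1F) (Aρ₀≤A 2F)
    where
    Aρ₀≤A : ∀ j → A (ρ ⟨$⟩ʳ 0F) ≤ A j
    Aρ₀≤A j = subst (λ i → A (ρ ⟨$⟩ʳ 0F) ≤ A i) (inverseʳ ρ) (Aρ↗ {0F} {ρ ⟨$⟩ˡ j} z≤n)
  sorted-load-bound ρ Aρ↗ 1F =
    c₂-load-bound (1F≢2F ∘ Injection.injective (↔⇒↣ ρ)) ℚ.≤-refl (Aρ↗ (s≤s z≤n))
    where
    1F≢2F : (Fin 3 ∋ 1F) ≢ 2F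
    1F≢2F ()
  sorted-load-bound ρ Aρ↗ 2F = c₃-load-bound (ρ ⟨$⟩ʳ 2F)

toℕ≤1⊎≡2F : ∀ (j : Fin 3) → Fin.toℕ j ℕ.≤ 1 ⊎ j ≡ 2F
toℕ≤1⊎≡2F 0F = inj₁ z≤n
toℕ≤1⊎≡2F 1F = inj₁ (s≤s z≤n)
toℕ≤1⊎≡2F 2F = inj₂ refl

top-two-meet : ∀ (π π' : Permutation′ 3) →
  ∃ λ i → Fin.toℕ (π ⟨$⟩ʳ i) ℕ.≤ 1 × Fin.toℕ (π' ⟨$⟩ʳ i) ℕ.≤ 1
top-two-meet π π' with toℕ≤1⊎≡2F (π' ⟨$⟩ʳ (π ⟨$⟩ˡ 0F)) | toℕ≤1⊎≡2F (π' ⟨$⟩ʳ (π ⟨$⟩ˡ 1F))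
... | inj₁ ≤1 | _ = π ⟨$⟩ˡ 0F , subst (λ j → Fin.toℕ j ℕ.≤ 1) (sym (inverseʳ π)) z≤n , ≤1
... | inj₂ _ | inj₁ ≤1 = π ⟨$⟩ˡ 1F , subst (λ j → Fin.toℕ j ℕ.≤ 1) (sym (inverseʳ π)) (s≤s z≤n) , ≤1
... | inj₂ ≡2F | inj₂ ≡2F' = ⊥-elim (Fin.0≢1+n (begin
  0F                 ≡⟨ inverseʳ π ⟨
  π ⟨$⟩ʳ (π ⟨$⟩ˡ 0F) ≡⟨ cong (π ⟨$⟩ʳ_) (π'-injective (trans ≡2F (sym ≡2F'))) ⟩
  π ⟨$⟩ʳ (π ⟨$⟩ˡ 1F) ≡⟨ inverseʳ π ⟩
  1F                 ∎))
  where
  open ≡-Reasoning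
  π'-injective = Injection.injective (↔⇒↣ π')

module _ {p : Times 3 3} (valid : ValidInstance p) where

  rank-antitone : ∀ r → Antitonic₁ Fin._≤_ _≤_ (p r)
  rank-antitone r {j'} {j} j≤j' = proj₁ (proj₂ valid) r j j' j≤j'

  ordered : Ordered (p 0F 0F) (p 0F 1F) (p 0F 2F) (p 1F 0F) (p 1F 1F) (p 1F 2F)
                    (p 2F 0F) (p 2F 1F) (p 2F 2F)
  ordered = record
    { a₂≤a₁ = rank-antitone 0F z≤n
    ; a₃≤a₂ = rank-antitone 0F (s≤s z≤n)
    ; b₁≤a₃ = proj₂ (proj₂ valid) 0F 1F 2F 0F (s≤s z≤n)
    ; b₂≤b₁ = rank-antitone 1F z≤n
    ; b₃≤b₂ = rank-antitone 1F (s≤s z≤n)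
    ; c₁≤b₃ = proj₂ (proj₂ valid) 1F 2F 2F 0F (s≤s (s≤s z≤n))
    ; c₂≤c₁ = rank-antitone 2F z≤n
    ; c₃≤c₂ = rank-antitone 2F (s≤s z≤n)
    ; 0≤c₃  = proj₁ valid 2F 2F
    }

  makespan-≥ : ∀ (τ : Schedule 3 3) i {j₀ j₁ j₂} →
    τ 0F ⟨$⟩ʳ i Fin.≤ j₀ → τ 1F ⟨$⟩ʳ i Fin.≤ j₁ → τ 2F ⟨$⟩ʳ i Fin.≤ j₂ →
    p 0F j₀ + p 1F j₁ + p 2F j₂ ≤ makespan p τ
  makespan-≥ τ i {j₀} {j₁} {j₂} τ₀≤j₀ τ₁≤j₁ τ₂≤j₂ = begin
    p 0F j₀ + p 1F j₁ + p 2F j₂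
      ≤⟨ rank-antitone 0F τ₀≤j₀ ⊕ rank-antitone 1F τ₁≤j₁ ⊕ rank-antitone 2F τ₂≤j₂ ⟩
    p 0F (τ 0F ⟨$⟩ʳ i) + p 1F (τ 1F ⟨$⟩ʳ i) + p 2F (τ 2F ⟨$⟩ʳ i)
      ≡⟨ sumFin-3 (λ r → p r (τ r ⟨$⟩ʳ i)) ⟨
    load p τ i
      ≤⟨ ≤-maxFin 3 (load p τ) i ⟩
    makespan p τ ∎
    where open ℚ.≤-Reasoning

  lowerBounds : (τ : Schedule 3 3) →
    LowerBounds (p 0F 0F) (p 0F 1F) (p 0F 2F) (p 1F 0F) (p 1F 1F) (p 1F 2F)
                (p 2F 0F) (p 2F 1F) (p 2F 2F) (makespan p τ)
  lowerBounds τ = record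
    { a₁+b₃+c₃≤t = makespan-≥ τ (τ 0F ⟨$⟩ˡ 0F) (holder (τ 0F) 0F) (≤fromℕ _) (≤fromℕ _)
    ; a₂+b₂+c₃≤t = let i , τ₀≤1 , τ₁≤1 = top-two-meet (τ 0F) (τ 1F)
                   in makespan-≥ τ i τ₀≤1 τ₁≤1 (≤fromℕ _)
    ; a₂+b₃+c₂≤t = let i , τ₀≤1 , τ₂≤1 = top-two-meet (τ 0F) (τ 2F)
                   in makespan-≥ τ i τ₀≤1 (≤fromℕ _) τ₂≤1
    ; a₃+b₁+c₃≤t = makespan-≥ τ (τ 1F ⟨$⟩ˡ 0F) (≤fromℕ _) (holder (τ 1F) 0F) (≤fromℕ _)
    ; a₃+b₃+c₁≤t = makespan-≥ τ (τ 2F ⟨$⟩ˡ 0F) (≤fromℕ _) (≤fromℕ _) (holder (τ 2F) 0F)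
    ; Σ≤3t       = total
    ; 0≤t        = 0≤maxFin 3 (load p τ)
    }
    where
    t : ℚ
    t = makespan p τ
    holder : ∀ (π : Permutation′ 3) j → π ⟨$⟩ʳ (π ⟨$⟩ˡ j) Fin.≤ j
    holder π j = Fin.≤-reflexive (inverseʳ π)
    row : Fin 3 → ℚ
    row r = p r 0F + p r 1F + p r 2F
    total : row 0F + row 1F + row 2F ≤ t + t + t
    total = begin
      row 0F + row 1F + row 2F
        ≡⟨ cong₂ _+_ (cong₂ _+_ (sumFin-3 (p 0F)) (sumFin-3 (p 1F))) (sumFin-3 (p 2F)) ⟨
      sumFin 3 (p 0F) + sumFin 3 (p 1F) + sumFin 3 (p 2F)
        ≡⟨ sumFin-3 (λ r → sumFin 3 (p r)) ⟨
      sumFin 3 (λ r → sumFin 3 (p r))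
        ≡⟨ sumFin-load p τ ⟨
      sumFin 3 (load p τ)
        ≤⟨ sumFin-mono 3 (≤-maxFin 3 (load p τ)) ⟩
      sumFin 3 (λ _ → t)
        ≡⟨ sumFin-3 (λ _ → t) ⟩
      t + t + t ∎
      where open ℚ.≤-Reasoning

module LD {p : Times 3 3} (valid : ValidInstance p) (σ : Schedule 3 3) (ld : IsLD p σ) where

  job : Fin 3 → Fin 3 → ℚ
  job r i = p r (σ r ⟨$⟩ʳ i)

  π₁ π₂ : Permutation′ 3
  π₁ = proj₁ (ld 1F)
  π₂ = proj₁ (ld 2F)

  loadBefore-1F : ∀ i → loadBefore p σ 1F i ≡ job 0F i
  loadBefore-1F i = ℚ.+-identityʳ (job 0F i)

  loadBefore-2F : ∀ i → loadBefore p σ 2F i ≡ job 0F i + job 1F i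
  loadBefore-2F i = cong (λ s → job 0F i + s) (ℚ.+-identityʳ (job 1F i))

  jobs-antitone : ∀ r → Antitonic₁ Fin._≤_ _≤_ (job r ∘ (proj₁ (ld r) ⟨$⟩ʳ_))
  jobs-antitone r {a} {b} b≤a = proj₂ (proj₂ (ld r) b a b≤a)

  first-rank-reversed : ∀ j → job 0F (π₁ ⟨$⟩ʳ j) ≡ p 0F (opposite j)
  first-rank-reversed = monotone-permute ℚ-poset (π₁ ∘ₚ σ 0F) (rank-antitone valid 0F)
    λ {a} {b} a≤b →
      subst₂ _≤_ (loadBefore-1F _) (loadBefore-1F _) (proj₁ (proj₂ (ld 1F) a b a≤b))

  second-rank-sorted : ∀ j → job 1F (π₁ ⟨$⟩ʳ j) ≡ p 1F j
  second-rank-sorted =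
    antitone-permute ℚ-poset (π₁ ∘ₚ σ 1F) (rank-antitone valid 1F) (jobs-antitone 1F)

  third-rank-sorted : ∀ k → job 2F (π₂ ⟨$⟩ʳ k) ≡ p 2F k
  third-rank-sorted =
    antitone-permute ℚ-poset (π₂ ∘ₚ σ 2F) (rank-antitone valid 2F) (jobs-antitone 2F)

  twoRankLoad : Fin 3 → ℚ
  twoRankLoad j = p 0F (opposite j) + p 1F j

  ρ : Permutation′ 3
  ρ = π₂ ∘ₚ flip π₁

  loadBefore-third : ∀ k → loadBefore p σ 2F (π₂ ⟨$⟩ʳ k) ≡ twoRankLoad (ρ ⟨$⟩ʳ k)
  loadBefore-third k = begin
    loadBefore p σ 2F (π₂ ⟨$⟩ʳ k)
      ≡⟨ loadBefore-2F _ ⟩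
    job 0F (π₂ ⟨$⟩ʳ k) + job 1F (π₂ ⟨$⟩ʳ k)
      ≡⟨ cong (λ i → job 0F i + job 1F i) (inverseʳ π₁) ⟨
    job 0F (π₁ ⟨$⟩ʳ (ρ ⟨$⟩ʳ k)) + job 1F (π₁ ⟨$⟩ʳ (ρ ⟨$⟩ʳ k))
      ≡⟨ cong₂ _+_ (first-rank-reversed _) (second-rank-sorted _) ⟩
    twoRankLoad (ρ ⟨$⟩ʳ k) ∎
    where open ≡-Reasoning

  twoRankLoad-sorted : Monotonic₁ Fin._≤_ _≤_ (twoRankLoad ∘ (ρ ⟨$⟩ʳ_))
  twoRankLoad-sorted {a} {b} a≤b =
    subst₂ _≤_ (loadBefore-third a) (loadBefore-third b) (proj₁ (proj₂ (ld 2F) a b a≤b))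

  load-split : ∀ i → let k = π₂ ⟨$⟩ˡ i in load p σ i ≡ twoRankLoad (ρ ⟨$⟩ʳ k) + p 2F k
  load-split i = begin
    load p σ i
      ≡⟨ cong (load p σ) (inverseʳ π₂) ⟨
    load p σ (π₂ ⟨$⟩ʳ k)
      ≡⟨ sumFin-3 (λ r → job r (π₂ ⟨$⟩ʳ k)) ⟩
    job 0F (π₂ ⟨$⟩ʳ k) + job 1F (π₂ ⟨$⟩ʳ k) + job 2F (π₂ ⟨$⟩ʳ k)
      ≡⟨ cong₂ _+_ (trans (sym (loadBefore-2F _)) (loadBefore-third k)) (third-rank-sorted k) ⟩
    twoRankLoad (ρ ⟨$⟩ʳ k) + p 2F k ∎
    where
    open ≡-Reasoning
    k = π₂ ⟨$⟩ˡ i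

LD-load-bound : ∀ {p : Times 3 3} → ValidInstance p → (σ : Schedule 3 3) → IsLD p σ →
  (τ : Schedule 3 3) → ∀ i → (+ 11 / 1) * load p σ i ≤ (+ 13 / 1) * makespan p τ
LD-load-bound {p} valid σ ld τ i =
  subst (λ u → (+ 11 / 1) * u ≤ (+ 13 / 1) * makespan p τ)
    (sym (trans (load-split i) (cong₂ _+_ (twoRankLoad≡A _) (c≡ _))))
    (sorted-load-bound ρ Aρ↗ (π₂ ⟨$⟩ˡ i))
  where
  open LD valid σ ld
  open Certificates (ordered valid) (lowerBounds valid τ)
  twoRankLoad≡A : ∀ j → twoRankLoad j ≡ A j
  twoRankLoad≡A 0F = refl
  twoRankLoad≡A 1F = refl
  twoRankLoad≡A 2F = refl
  c≡ : ∀ k → p 2F k ≡ c k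
  c≡ 0F = refl
  c≡ 1F = refl
  c≡ 2F = refl
  Aρ↗ : Monotonic₁ Fin._≤_ _≤_ (A ∘ (ρ ⟨$⟩ʳ_))
  Aρ↗ = subst₂ _≤_ (twoRankLoad≡A _) (twoRankLoad≡A _) ∘ twoRankLoad-sorted

proposition4p4 : (p : Times 3 3) → ValidInstance p →
    (σ : Schedule 3 3) → IsLD p σ →
    (τ : Schedule 3 3) →
    (+ 11 / 1) * makespan p σ ≤ (+ 13 / 1) * makespan p τ
proposition4p4 p valid σ ld τ = begin
  (+ 11 / 1) * makespan p σ                ≡⟨ *-distribˡ-maxFin (+ 11 / 1) 3 (load p σ) ⟩
  maxFin 3 (λ i → (+ 11 / 1) * load p σ i) ≤⟨ maxFin-lub 3 (LD-load-bound valid σ ld τ) 0≤13t ⟩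
  (+ 13 / 1) * makespan p τ                ∎
  where
  open ℚ.≤-Reasoning
  0≤13t : 0ℚ ≤ (+ 13 / 1) * makespan p τ
  0≤13t = subst (_≤ (+ 13 / 1) * makespan p τ) (ℚ.*-zeroʳ (+ 13 / 1))
    ((+ 13 / 1) ⊗ 0≤maxFin 3 (load p τ))
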